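{- Let $n=2^r-1$, let $C$ be a binary perfect code of length $n$, $i$ a coordinate, and $I,I'$ the sets of $i$-even and $i$-odd codewords of $C$. Let $I_1$ (resp. $I'_1$) be the set of vectors at distance exactly $1$ from $I\cup(I+e_i)$ (resp. from $I'\cup(I'+e_i)$). Then the coloring of the vertices of the binary Hamming graph on $\mathbf{F}^n$ into the six colors $I,\ I+e_i,\ I_1,\ I'_1,\ I'+e_i,\ I'$ is a perfect coloring with parameter matrix (rows and columns in this order) $$\begin{pmatrix}0&1&n-1&0&0&0\\ 1&0&n-1&0&0&0\\ 1&1&1&n-3&0&0\\ 0&0&n-3&1&1&1\\ 0&0&0&n-1&0&1\\ 0&0&0&n-1&1&0\end{pmatrix},$$ and the coloring into the four colors $I\cup(I+e_i),\ I_1,\ I'_1,\ I'\cup(I'+e_i)$ is a perfect coloring with parameter matrix $$\begin{pmatrix}1&n-1&0&0\\ 2&1&n-3&0\\ 0&n-3&1&2\\ 0&0&n-1&1\end{pmatrix}.$$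
   Context: The binary Hamming graph on $\mathbf{F}^n$ has edges between vectors at Hamming distance $1$; $e_i$ is the $i$-th unit vector. A perfect code of length $n=2^r-1$ is a binary code with minimum distance $3$ and $2^n/(n+1)$ codewords. A codeword $x$ is $i$-even if the number of ones of $x$ outside coordinate $i$ is even, and $i$-odd otherwise. A partition of the vertex set into color classes $1,\dots,t$ is a perfect coloring with parameter matrix $A=(A_{ab})$ if every vertex of color $a$ has exactly $A_{ab}$ neighbors of color $b$, for all $a,b$. -}

module Defs where

open import Data.Bool using (Bool; true; false; not; _∧_; _∨_; if_then_else_)
open import Data.Nat using (ℕ; zero; suc; _+_; _*_; _∸_; _^_; _≤_)
open import Data.Fin using (Fin)
open import Data.Vec using (Vec; []; _∷_; lookup; updateAt; zipWith; toList)
open import Data.List using (List; []; _∷_; map; allFin; _++_)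
open import Data.Nat.ListAction using (sum)
open import Data.Bool.ListAction using (any)
open import Data.Product using (Σ; _×_)
open import Relation.Binary.PropositionalEquality using (_≡_; _≢_)
open import Relation.Nullary using (¬_)

Word : ℕ → Set
Word n = Vec Bool n

VSet : ℕ → Set
VSet n = Word n → Bool

_∈_ : ∀ {n} → Word n → VSet n → Set
x ∈ S = S x ≡ true

flip : ∀ {n} → Fin n → Word n → Word n
flip j x = updateAt x j not

weight : ∀ {n} → Word n → ℕ
weight [] = 0
weight (false ∷ xs) = weight xs
weight (true ∷ xs) = suc (weight xs)

xor : Bool → Bool → Bool
xor a b = if a then not b else b

dist : ∀ {n} → Word n → Word n → ℕ
dist x y = weight (zipWith xor x y)

allWords : ∀ n → List (Word n)
allWords zero = [] ∷ []
allWords (suc n) = map (false ∷_) (allWords n) ++ map (true ∷_) (allWords n)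

card : ∀ {n} → VSet n → ℕ
card {n} S = sum (map (λ x → if S x then 1 else 0) (allWords n))

IsPerfectCode : ∀ {n} → VSet n → Set
IsPerfectCode {n} C =
  ((x y : Word n) → x ∈ C → y ∈ C → x ≢ y → 3 ≤ dist x y)
  × (card C * (n + 1) ≡ 2 ^ n)

isEven : ℕ → Bool
isEven zero = true
isEven (suc k) = not (isEven k)

iEven : ∀ {n} → Fin n → Word n → Bool
iEven i x = isEven (weight (updateAt x i (λ _ → false)))

_∪_ : ∀ {n} → VSet n → VSet n → VSet n
(S ∪ T) x = S x ∨ T x

shift : ∀ {n} → VSet n → Fin n → VSet n
shift S i x = S (flip i x)

distOne : ∀ {n} → VSet n → VSet n
distOne {n} S x = not (S x) ∧ any (λ j → S (flip j x)) (allFin n)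

evenPart : ∀ {n} → VSet n → Fin n → VSet n
evenPart C i x = C x ∧ iEven i x

oddPart : ∀ {n} → VSet n → Fin n → VSet n
oddPart C i x = C x ∧ not (iEven i x)

nbrCount : ∀ {n} → VSet n → Word n → ℕ
nbrCount {n} S x = sum (map (λ j → if S (flip j x) then 1 else 0) (allFin n))

IsPerfectColoring : ∀ {n t} → (Fin t → VSet n) → (Fin t → Fin t → ℕ) → Set
IsPerfectColoring {n} {t} S A =
  ((x : Word n) → Σ (Fin t) (λ a → x ∈ S a))
  × ((x : Word n) (a b : Fin t) → x ∈ S a → x ∈ S b → a ≡ b)
  × ((x : Word n) (a b : Fin t) → x ∈ S a → nbrCount (S b) x ≡ A a b)

mat : ∀ {t} → Vec (Vec ℕ t) t → Fin t → Fin t → ℕ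
mat M a b = lookup (lookup M a) b

sixClasses : ∀ {n} → VSet n → Fin n → Vec (VSet n) 6
sixClasses C i =
  I ∷ shift I i ∷ distOne (I ∪ shift I i) ∷ distOne (I' ∪ shift I' i)
    ∷ shift I' i ∷ I' ∷ []
  where
  I  = evenPart C i
  I' = oddPart C i

fourClasses : ∀ {n} → VSet n → Fin n → Vec (VSet n) 4
fourClasses C i =
  (I ∪ shift I i) ∷ distOne (I ∪ shift I i) ∷ distOne (I' ∪ shift I' i)
    ∷ (I' ∪ shift I' i) ∷ []
  where
  I  = evenPart C i
  I' = oddPart C i

sixMatrix : ℕ → Vec (Vec ℕ 6) 6
sixMatrix n =
    (0 ∷ 1 ∷ n ∸ 1 ∷ 0     ∷ 0 ∷ 0 ∷ [])
  ∷ (1 ∷ 0 ∷ n ∸ 1 ∷ 0     ∷ 0 ∷ 0 ∷ [])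
  ∷ (1 ∷ 1 ∷ 1     ∷ n ∸ 3 ∷ 0 ∷ 0 ∷ [])
  ∷ (0 ∷ 0 ∷ n ∸ 3 ∷ 1     ∷ 1 ∷ 1 ∷ [])
  ∷ (0 ∷ 0 ∷ 0     ∷ n ∸ 1 ∷ 0 ∷ 1 ∷ [])
  ∷ (0 ∷ 0 ∷ 0     ∷ n ∸ 1 ∷ 1 ∷ 0 ∷ [])
  ∷ []

fourMatrix : ℕ → Vec (Vec ℕ 4) 4
fourMatrix n =
    (1 ∷ n ∸ 1 ∷ 0     ∷ 0 ∷ [])
  ∷ (2 ∷ 1     ∷ n ∸ 3 ∷ 0 ∷ [])
  ∷ (0 ∷ n ∸ 3 ∷ 1     ∷ 2 ∷ [])
  ∷ (0 ∷ 0     ∷ n ∸ 1 ∷ 1 ∷ [])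
  ∷ []

-- Since C is perfect, the balls of radius 1 about its codewords partition F^n, so every vertex y
-- either lies in C or is adjacent to exactly one codeword c, along exactly one coordinate j. Colour y
-- by its kind (y ∈ C, y = c + e_i, or y = c + e_j with j ≠ i) and by the i-parity of c; this gives the
-- six classes. As distinct codewords are at distance at least 3, the colours around y are forced:
-- a codeword and its partner across coordinate i see each other and n - 1 vertices of the third kind
-- with the same parity, while y = c + e_j (j ≠ i) sees c, the vertex y + e_i, and c' + e_i where c' is
-- the codeword nearest to y + e_i, all with the parity of c, plus n - 3 vertices of the third kind
-- with the opposite parity. These counts are the two matrices; in particular the third kind with a
-- given parity is exactly the set of vertices at distance one from I ∪ (I + e_i), resp. I' ∪ (I' + e_i).

module Submission where

open import Defs
open import Data.Bool using (Bool; true; false; not; _∧_; _∨_; if_then_else_)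
import Data.Bool.Properties as Bool
open import Data.Bool.Properties using (not-involutive; not-¬; ¬-not)
open import Data.Bool.ListAction using (any; or)
open import Data.Fin using (Fin; zero; suc)
open import Data.Fin.Patterns using (0F; 1F; 2F; 3F; 4F; 5F)
open import Data.Fin.Properties using (_≟_; any?)
open import Data.List as List using (List; []; _∷_; map; allFin; _++_; length)
open import Data.List.Properties using (map-tabulate; map-++; map-∘; length-++; length-map)
open import Data.List.Relation.Unary.All using (All; []; _∷_)
open import Data.List.Relation.Unary.All.Properties using (++⁻ˡ; ++⁻ʳ; map⁻)
open import Data.List.Relation.Unary.AllPairs using ([]; _∷_)
open import Data.List.Relation.Unary.Unique.Propositional using (Unique)
open import Data.Nat using (ℕ; zero; suc; _+_; _*_; _∸_; _^_; _≤_; _<ᵇ_; z≤n; s≤s)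
open import Data.Nat.ListAction using (sum)
open import Data.Nat.ListAction.Properties using (sum-++)
open import Data.Nat.Properties
  using (≤-refl; ≤-reflexive; ≤-trans; n≤1+n; m≤n⇒m≤1+n; 1+n≰n; <⇒≱; +-mono-≤; suc-injective;
         +-assoc; +-comm; +-identityʳ; *-comm; *-suc; *-identityʳ; *-zeroʳ; *-distribʳ-∸; m+n∸m≡n;
         +-0-commutativeMonoid; +-commutativeSemigroup)
open import Algebra.Properties.CommutativeMonoid.Sum +-0-commutativeMonoid
  using (sum-syntax; sum-cong-≗; ∑-distrib-+)
open import Algebra.Properties.CommutativeSemigroup +-commutativeSemigroup
  using (interchange; x∙yz≈y∙xz)
open import Data.Product using (Σ; ∃; _×_; _,_; uncurry)
open import Data.Vec as Vec using (Vec; []; _∷_; lookup; updateAt; tabulate)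
open import Data.Vec.Properties
  using (updateAt-updateAt-local; updateAt-updateAt; updateAt-id; updateAt-commutes;
         lookup∘updateAt; lookup∘updateAt′; ≡-dec; lookup-map; lookup∘tabulate)
open import Data.Vec.Relation.Binary.Pointwise.Inductive using ([]; _∷_; Pointwise-≡⇒≡)
open import Function using (_∘_; id)
open import Relation.Binary.PropositionalEquality
open import Relation.Nullary using (¬_; does; yes; no; contradiction)
open import Relation.Nullary.Decidable using (dec-true; dec-false; decidable-stable)

open ≡-Reasoning

-- The Hamming space

flip-involutive : ∀ {n} j (x : Word n) → flip j (flip j x) ≡ x
flip-involutive j x = trans (updateAt-updateAt-local j x (not-involutive _)) (updateAt-id j x)

flip-comm : ∀ {n} j k (x : Word n) → flip j (flip k x) ≡ flip k (flip j x)
flip-comm j k x with j ≟ k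
... | yes refl = refl
... | no j≢k  = updateAt-commutes j k j≢k x

flip-injectiveˡ : ∀ {n} {j k} (x : Word n) → flip j x ≡ flip k x → j ≡ k
flip-injectiveˡ {j = j} {k} x eq with j ≟ k
... | yes j≡k = j≡k
... | no j≢k  = contradiction flipped (not-¬ refl)
  where
  flipped : lookup x j ≡ not (lookup x j)
  flipped = begin
    lookup x j             ≡⟨ lookup∘updateAt′ j k j≢k x ⟨
    lookup (flip k x) j    ≡⟨ cong (λ z → lookup z j) eq ⟨
    lookup (flip j x) j    ≡⟨ lookup∘updateAt j x ⟩
    not (lookup x j)       ∎

flip-≢ : ∀ {n} j (x : Word n) → flip j x ≢ x
flip-≢ j x eq = not-¬ refl (sym (trans (sym (lookup∘updateAt j x)) (cong (λ z → lookup z j) eq)))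

dist-self : ∀ {n} (x : Word n) → dist x x ≡ 0
dist-self []          = refl
dist-self (true ∷ x)  = dist-self x
dist-self (false ∷ x) = dist-self x

dist-flip : ∀ {n} j (x y : Word n) → dist x (flip j y) ≤ suc (dist x y)
dist-flip zero    (true  ∷ x) (true  ∷ y) = ≤-refl
dist-flip zero    (true  ∷ x) (false ∷ y) = m≤n⇒m≤1+n (n≤1+n _)
dist-flip zero    (false ∷ x) (true  ∷ y) = m≤n⇒m≤1+n (n≤1+n _)
dist-flip zero    (false ∷ x) (false ∷ y) = ≤-refl
dist-flip (suc j) (true  ∷ x) (true  ∷ y) = dist-flip j x y
dist-flip (suc j) (true  ∷ x) (false ∷ y) = s≤s (dist-flip j x y)
dist-flip (suc j) (false ∷ x) (true  ∷ y) = s≤s (dist-flip j x y)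
dist-flip (suc j) (false ∷ x) (false ∷ y) = dist-flip j x y

dist-flip₁ : ∀ {n} j (x : Word n) → dist x (flip j x) ≤ 1
dist-flip₁ j x = ≤-trans (dist-flip j x x) (s≤s (≤-reflexive (dist-self x)))

dist-flip₂ : ∀ {n} a b (x : Word n) → dist x (flip a (flip b x)) ≤ 2
dist-flip₂ a b x = ≤-trans (dist-flip a x (flip b x)) (s≤s (dist-flip₁ b x))

isEven-weight-flip : ∀ {n} j (y : Word n) → isEven (weight (flip j y)) ≡ not (isEven (weight y))
isEven-weight-flip zero    (true  ∷ y) = sym (not-involutive _)
isEven-weight-flip zero    (false ∷ y) = refl
isEven-weight-flip (suc j) (true  ∷ y) = cong not (isEven-weight-flip j y)
isEven-weight-flip (suc j) (false ∷ y) = isEven-weight-flip j y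

iEven-flip-self : ∀ {n} i (x : Word n) → iEven i (flip i x) ≡ iEven i x
iEven-flip-self i x = cong (isEven ∘ weight) (updateAt-updateAt i x)

iEven-flip : ∀ {n} {i j} (x : Word n) → j ≢ i → iEven i (flip j x) ≡ not (iEven i x)
iEven-flip {i = i} {j} x j≢i =
  trans (cong (isEven ∘ weight) (updateAt-commutes i j (j≢i ∘ sym) x))
        (isEven-weight-flip j (updateAt x i (λ _ → false)))

not-iEven-flip : ∀ {n} {i j} (x : Word n) → j ≢ i → not (iEven i (flip j x)) ≡ iEven i x
not-iEven-flip x j≢i = trans (cong not (iEven-flip x j≢i)) (not-involutive _)

-- Finite sums

bit : Bool → ℕ
bit b = if b then 1 else 0

bit-≤1 : ∀ b → bit b ≤ 1
bit-≤1 true  = ≤-refl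
bit-≤1 false = z≤n

*-bit : ∀ m b → m * bit b ≡ (if b then m else 0)
*-bit m true  = *-identityʳ m
*-bit m false = *-zeroʳ m

∑-const : ∀ n v → ∑[ l < n ] v ≡ n * v
∑-const zero    v = refl
∑-const (suc n) v = cong (v +_) (∑-const n v)

∑-zero : ∀ {n} (h : Fin n → ℕ) → (∀ l → h l ≡ 0) → ∑[ l < n ] h l ≡ 0
∑-zero {n} h h≡0 = trans (sum-cong-≗ h≡0) (trans (∑-const n 0) (*-zeroʳ n))

eraseAt : ∀ {n} → Fin n → (Fin n → ℕ) → Fin n → ℕ
eraseAt j h l = if does (l ≟ j) then 0 else h l

erase : ∀ {n} → List (Fin n) → (Fin n → ℕ) → Fin n → ℕ
erase []       h = h
erase (j ∷ js) h = eraseAt j (erase js h)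

∑-eraseAt : ∀ {n} (h : Fin n → ℕ) j → ∑[ l < n ] h l ≡ h j + ∑[ l < n ] eraseAt j h l
∑-eraseAt {suc n} h zero    = refl
∑-eraseAt {suc n} h (suc j) =
  trans (cong (h zero +_) (∑-eraseAt (h ∘ suc) j)) (x∙yz≈y∙xz (h zero) (h (suc j)) _)

∑-single : ∀ {n} (h : Fin n → ℕ) j → (∀ l → l ≢ j → h l ≡ 0) → ∑[ l < n ] h l ≡ h j
∑-single h j others = begin
  ∑[ l < _ ] h l                  ≡⟨ ∑-eraseAt h j ⟩
  h j + ∑[ l < _ ] eraseAt j h l  ≡⟨ cong (h j +_) (∑-zero (eraseAt j h) erased) ⟩
  h j + 0                         ≡⟨ +-identityʳ (h j) ⟩
  h j                             ∎
  where
  erased : ∀ l → eraseAt j h l ≡ 0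
  erased l with l ≟ j
  ... | yes _   = refl
  ... | no l≢j = others l l≢j

erase-outside : ∀ {n} (js : List (Fin n)) h {l} → All (l ≢_) js → erase js h l ≡ h l
erase-outside []       h []            = refl
erase-outside (j ∷ js) h {l} (l≢j ∷ l∉js)
  rewrite dec-false (l ≟ j) l≢j = erase-outside js h l∉js

erase-cong : ∀ {n} (js : List (Fin n)) {h g : Fin n → ℕ} l
  → (All (l ≢_) js → h l ≡ g l) → erase js h l ≡ erase js g l
erase-cong []       l eq = eq []
erase-cong (j ∷ js) l eq with l ≟ j
... | yes _   = refl
... | no l≢j = erase-cong js l (eq ∘ (l≢j ∷_))

∑-erase : ∀ {n} (h : Fin n → ℕ) {js} → Unique js
  → ∑[ l < n ] h l ≡ sum (map h js) + ∑[ l < n ] erase js h l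
∑-erase h []                          = refl
∑-erase {n} h {j ∷ js} (j∉js ∷ distinct) = begin
  ∑[ l < n ] h l                               ≡⟨ ∑-erase h distinct ⟩
  sum (map h js) + ∑[ l < n ] erase js h l     ≡⟨ cong (sum (map h js) +_) (∑-eraseAt (erase js h) j) ⟩
  sum (map h js) + (erase js h j + rest)
    ≡⟨ cong (λ v → sum (map h js) + (v + rest)) (erase-outside js h j∉js) ⟩
  sum (map h js) + (h j + rest)                ≡⟨ x∙yz≈y∙xz (sum (map h js)) (h j) rest ⟩
  h j + (sum (map h js) + rest)                ≡⟨ +-assoc (h j) (sum (map h js)) rest ⟨
  sum (map h (j ∷ js)) + rest                  ∎
  where
  rest : ℕ
  rest = ∑[ l < n ] erase (j ∷ js) h l

sum-map-const : ∀ {A : Set} (xs : List A) v → sum (map (λ _ → v) xs) ≡ length xs * v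
sum-map-const []       v = refl
sum-map-const (x ∷ xs) v = cong (v +_) (sum-map-const xs v)

∑-default : ∀ {n} (h : Fin n → ℕ) (js : List (Fin n)) v → Unique js
  → (∀ l → All (l ≢_) js → h l ≡ v)
  → ∑[ l < n ] h l ≡ sum (map h js) + (n ∸ length js) * v
∑-default {n} h js v distinct outside = begin
  ∑[ l < n ] h l                              ≡⟨ ∑-erase h distinct ⟩
  sum (map h js) + ∑[ l < n ] erase js h l    ≡⟨ cong (sum (map h js) +_) erased ⟩
  sum (map h js) + (n ∸ length js) * v        ∎
  where
  rest : ℕ
  rest = ∑[ l < n ] erase js (λ _ → v) l
  constant : n * v ≡ length js * v + rest
  constant = begin
    n * v                              ≡⟨ ∑-const n v ⟨
    ∑[ l < n ] v                       ≡⟨ ∑-erase (λ _ → v) distinct ⟩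
    sum (map (λ _ → v) js) + rest      ≡⟨ cong (_+ rest) (sum-map-const js v) ⟩
    length js * v + rest               ∎
  erased : ∑[ l < n ] erase js h l ≡ (n ∸ length js) * v
  erased = begin
    ∑[ l < n ] erase js h l            ≡⟨ sum-cong-≗ (λ l → erase-cong js l (outside l)) ⟩
    rest                               ≡⟨ m+n∸m≡n (length js * v) rest ⟨
    length js * v + rest ∸ length js * v ≡⟨ cong (_∸ length js * v) constant ⟨
    n * v ∸ length js * v              ≡⟨ *-distribʳ-∸ v n (length js) ⟨
    (n ∸ length js) * v                ∎

∑-bit-≤1 : ∀ {n} (g : Fin n → Bool) → (∀ j k → g j ≡ true → g k ≡ true → j ≡ k)
  → ∑[ l < n ] bit (g l) ≤ 1
∑-bit-≤1 g atMostOne with any? (λ j → g j Bool.≟ true)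
... | yes (j , gj) = ≤-trans (≤-reflexive (∑-single (bit ∘ g) j others)) (bit-≤1 (g j))
  where
  others : ∀ l → l ≢ j → bit (g l) ≡ 0
  others l l≢j with g l in gl
  ... | true  = contradiction (atMostOne l j gl gj) l≢j
  ... | false = refl
... | no none = ≤-trans (≤-reflexive (∑-zero (bit ∘ g) λ l → cong bit (¬-not (none ∘ (l ,_))))) z≤n

∑-bit-witness : ∀ {n} (g : Fin n → Bool) → ∑[ l < n ] bit (g l) ≢ 0 → ∃ λ l → g l ≡ true
∑-bit-witness g ∑≢0 with any? (λ l → g l Bool.≟ true)
... | yes found = found
... | no none  = contradiction (∑-zero (bit ∘ g) λ l → cong bit (¬-not (none ∘ (l ,_)))) ∑≢0

sum-allFin : ∀ {n} (h : Fin n → ℕ) → sum (map h (allFin n)) ≡ ∑[ l < n ] h l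
sum-allFin h = trans (cong sum (map-tabulate id h)) (sum-tabulate h)
  where
  sum-tabulate : ∀ {n} (h : Fin n → ℕ) → sum (List.tabulate h) ≡ ∑[ l < n ] h l
  sum-tabulate {zero}  h = refl
  sum-tabulate {suc n} h = cong (h zero +_) (sum-tabulate (h ∘ suc))

any-allFin : ∀ {n} (g : Fin n → Bool) → any g (allFin n) ≡ (0 <ᵇ ∑[ l < n ] bit (g l))
any-allFin g = trans (cong or (map-tabulate id g)) (or-tabulate g)
  where
  or-tabulate : ∀ {n} (g : Fin n → Bool) → or (List.tabulate g) ≡ (0 <ᵇ ∑[ l < n ] bit (g l))
  or-tabulate {zero}  g = refl
  or-tabulate {suc n} g with g zero
  ... | true  = refl
  ... | false = or-tabulate (g ∘ suc)

module _ {A : Set} where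

  sum-map-+ : (f g : A → ℕ) (xs : List A)
    → sum (map (λ x → f x + g x) xs) ≡ sum (map f xs) + sum (map g xs)
  sum-map-+ f g []       = refl
  sum-map-+ f g (x ∷ xs) =
    trans (cong (f x + g x +_) (sum-map-+ f g xs)) (interchange (f x) (g x) _ _)

  sum-map-∑ : ∀ {n} (g : A → Fin n → ℕ) (xs : List A)
    → sum (map (λ x → ∑[ j < n ] g x j) xs) ≡ ∑[ j < n ] sum (map (λ x → g x j) xs)
  sum-map-∑ {n} g []       = sym (∑-zero {n} (λ _ → 0) (λ _ → refl))
  sum-map-∑ {n} g (x ∷ xs) =
    trans (cong (∑[ j < n ] g x j +_) (sum-map-∑ g xs)) (sym (∑-distrib-+ (g x) _))

  sum-map-≤length : (f : A → ℕ) → (∀ x → f x ≤ 1) → ∀ xs → sum (map f xs) ≤ length xs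
  sum-map-≤length f f≤1 []       = z≤n
  sum-map-≤length f f≤1 (x ∷ xs) = +-mono-≤ (f≤1 x) (sum-map-≤length f f≤1 xs)

  sum-map≡length⇒≡1 : (f : A → ℕ) → (∀ x → f x ≤ 1) → ∀ xs
    → sum (map f xs) ≡ length xs → All (λ x → f x ≡ 1) xs
  sum-map≡length⇒≡1 f f≤1 []       _  = []
  sum-map≡length⇒≡1 f f≤1 (x ∷ xs) eq with f x in fx | f≤1 x
  ... | 0 | _ = contradiction (≤-trans (≤-reflexive (sym eq)) (sum-map-≤length f f≤1 xs)) 1+n≰n
  ... | 1 | _ = fx ∷ sum-map≡length⇒≡1 f f≤1 xs (suc-injective eq)
  ... | suc (suc _) | s≤s ()

sumWords : ∀ n → (Word n → ℕ) → ℕ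
sumWords n f = sum (map f (allWords n))

sumWords-suc : ∀ n (f : Word (suc n) → ℕ)
  → sumWords (suc n) f ≡ sumWords n (f ∘ (false ∷_)) + sumWords n (f ∘ (true ∷_))
sumWords-suc n f = begin
  sum (map f (map (false ∷_) W ++ map (true ∷_) W))             ≡⟨ cong sum (map-++ f (map (false ∷_) W) _) ⟩
  sum (map f (map (false ∷_) W) ++ map f (map (true ∷_) W))     ≡⟨ sum-++ (map f (map (false ∷_) W)) _ ⟩
  sum (map f (map (false ∷_) W)) + sum (map f (map (true ∷_) W))
    ≡⟨ cong₂ _+_ (cong sum (map-∘ W)) (cong sum (map-∘ W)) ⟨
  sumWords n (f ∘ (false ∷_)) + sumWords n (f ∘ (true ∷_))     ∎
  where
  W = allWords n

sumWords-flip : ∀ n j (f : Word n → ℕ) → sumWords n (f ∘ flip j) ≡ sumWords n f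
sumWords-flip (suc n) zero f = begin
  sumWords (suc n) (f ∘ flip zero)                          ≡⟨ sumWords-suc n (f ∘ flip zero) ⟩
  sumWords n (f ∘ (true ∷_)) + sumWords n (f ∘ (false ∷_))  ≡⟨ +-comm (sumWords n (f ∘ (true ∷_))) _ ⟩
  sumWords n (f ∘ (false ∷_)) + sumWords n (f ∘ (true ∷_))  ≡⟨ sumWords-suc n f ⟨
  sumWords (suc n) f                                        ∎
sumWords-flip (suc n) (suc j) f = begin
  sumWords (suc n) (f ∘ flip (suc j))  ≡⟨ sumWords-suc n (f ∘ flip (suc j)) ⟩
  sumWords n (f ∘ (false ∷_) ∘ flip j) + sumWords n (f ∘ (true ∷_) ∘ flip j)
    ≡⟨ cong₂ _+_ (sumWords-flip n j (f ∘ (false ∷_))) (sumWords-flip n j (f ∘ (true ∷_))) ⟩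
  sumWords n (f ∘ (false ∷_)) + sumWords n (f ∘ (true ∷_)) ≡⟨ sumWords-suc n f ⟨
  sumWords (suc n) f                   ∎

length-allWords : ∀ n → length (allWords n) ≡ 2 ^ n
length-allWords zero    = refl
length-allWords (suc n) = begin
  length (map (false ∷_) W ++ map (true ∷_) W)             ≡⟨ length-++ (map (false ∷_) W) ⟩
  length (map (false ∷_) W) + length (map (true ∷_) W)     ≡⟨ cong₂ _+_ (length-map _ W) (length-map _ W) ⟩
  length W + length W                                       ≡⟨ cong₂ _+_ (length-allWords n) (length-allWords n) ⟩
  2 ^ n + 2 ^ n                                             ≡⟨ cong (2 ^ n +_) (+-identityʳ (2 ^ n)) ⟨
  2 ^ suc n                                                 ∎
  where
  W = allWords n

allWords-complete : ∀ {n} {P : Word n → Set} → All P (allWords n) → ∀ x → P x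
allWords-complete {zero}  (p ∷ []) []          = p
allWords-complete {suc n} ps       (false ∷ x) = allWords-complete (map⁻ (++⁻ˡ _ ps)) x
allWords-complete {suc n} ps       (true ∷ x)  = allWords-complete (map⁻ (++⁻ʳ _ ps)) x

does-≟-true : ∀ {t} {a b : Fin t} → does (a ≟ b) ≡ true → a ≡ b
does-≟-true {a = a} {b} eq with a ≟ b
... | yes a≡b = a≡b
... | no _ with () ← eq

perfectColoring : ∀ {n t} (S : Fin t → VSet n) (κ : Word n → Fin t) (A : Fin t → Fin t → ℕ)
  → (∀ a y → S a y ≡ does (κ y ≟ a))
  → (∀ y b → ∑[ l < n ] bit (does (κ (flip l y) ≟ b)) ≡ A (κ y) b)
  → IsPerfectColoring S A
perfectColoring {n} S κ A classes counts = covered , disjoint , regular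
  where
  colour-of : ∀ {a x} → x ∈ S a → κ x ≡ a
  colour-of {a} {x} x∈S = does-≟-true (trans (sym (classes a x)) x∈S)
  covered : ∀ x → Σ _ (λ a → x ∈ S a)
  covered x = κ x , trans (classes (κ x) x) (dec-true (κ x ≟ κ x) refl)
  disjoint : ∀ x a b → x ∈ S a → x ∈ S b → a ≡ b
  disjoint x a b x∈Sa x∈Sb = trans (sym (colour-of x∈Sa)) (colour-of x∈Sb)
  regular : ∀ x a b → x ∈ S a → nbrCount (S b) x ≡ A a b
  regular x a b x∈Sa = begin
    nbrCount (S b) x                         ≡⟨ sum-allFin (λ l → bit (S b (flip l x))) ⟩
    ∑[ l < n ] bit (S b (flip l x))          ≡⟨ sum-cong-≗ (λ l → cong bit (classes b (flip l x))) ⟩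
    ∑[ l < n ] bit (does (κ (flip l x) ≟ b)) ≡⟨ counts x b ⟩
    A (κ x) b                                ≡⟨ cong (λ a′ → A a′ b) (colour-of x∈Sa) ⟩
    A a b                                    ∎

-- Perfect codes

module PerfectCode {n} (C : VSet n)
  (separated : (x y : Word n) → x ∈ C → y ∈ C → x ≢ y → 3 ≤ dist x y)
  (size : card C * (n + 1) ≡ 2 ^ n) where

  codewords-close⇒≡ : ∀ {c c′} → c ∈ C → c′ ∈ C → dist c c′ ≤ 2 → c ≡ c′
  codewords-close⇒≡ {c} {c′} c∈C c′∈C d = decidable-stable (≡-dec Bool._≟_ c c′)
    λ c≢c′ → <⇒≱ (separated c c′ c∈C c′∈C c≢c′) d

  flip-∉ : ∀ {c} j → c ∈ C → ¬ (flip j c ∈ C)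
  flip-∉ {c} j c∈C fc∈C =
    flip-≢ j c (sym (codewords-close⇒≡ c∈C fc∈C (m≤n⇒m≤1+n (dist-flip₁ j c))))

  flip-flip-∈⇒≡ : ∀ {c} a b → c ∈ C → flip a (flip b c) ∈ C → a ≡ b
  flip-flip-∈⇒≡ {c} a b c∈C ffc∈C = sym (flip-injectiveˡ c (begin
    flip b c                       ≡⟨ flip-involutive a (flip b c) ⟨
    flip a (flip a (flip b c))     ≡⟨ cong (flip a) (codewords-close⇒≡ c∈C ffc∈C (dist-flip₂ a b c)) ⟨
    flip a c                       ∎))

  ∈-refold : ∀ {x} l (f : Word n → Word n) → f x ∈ C → f (flip l (flip l x)) ∈ C
  ∈-refold {x} l f = subst (λ z → f z ∈ C) (sym (flip-involutive l x))

  near-unique : ∀ {x j k} → flip j x ∈ C → flip k x ∈ C → j ≡ k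
  near-unique {x} {j} {k} j∈C k∈C =
    sym (flip-flip-∈⇒≡ k j j∈C (∈-refold j (flip k) k∈C))

  ballCount : Word n → ℕ
  ballCount x = bit (C x) + ∑[ j < n ] bit (C (flip j x))

  ballCount-≤1 : ∀ x → ballCount x ≤ 1
  ballCount-≤1 x with C x in x∈C
  ... | true  = ≤-reflexive (cong suc (∑-zero (λ j → bit (C (flip j x)))
                                              (λ j → cong bit (¬-not (flip-∉ j x∈C)))))
  ... | false = ∑-bit-≤1 (λ j → C (flip j x)) (λ j k → near-unique)

  sumWords-ballCount : sumWords n ballCount ≡ card C * (n + 1)
  sumWords-ballCount = begin
    sumWords n ballCount                 ≡⟨ sum-map-+ (bit ∘ C) (λ x → ∑[ j < n ] g x j) W ⟩
    card C + sumWords n (λ x → ∑[ j < n ] g x j) ≡⟨ cong (card C +_) (sum-map-∑ g W) ⟩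
    card C + ∑[ j < n ] sumWords n (λ x → g x j)
      ≡⟨ cong (card C +_) (sum-cong-≗ λ j → sumWords-flip n j (bit ∘ C)) ⟩
    card C + ∑[ j < n ] card C           ≡⟨ cong (card C +_) (∑-const n (card C)) ⟩
    card C + n * card C                  ≡⟨ cong (card C +_) (*-comm n (card C)) ⟩
    card C + card C * n                  ≡⟨ *-suc (card C) n ⟨
    card C * suc n                       ≡⟨ cong (card C *_) (+-comm n 1) ⟨
    card C * (n + 1)                     ∎
    where
    W = allWords n
    g : Word n → Fin n → ℕ
    g x j = bit (C (flip j x))

  ballCount≡1 : ∀ x → ballCount x ≡ 1
  ballCount≡1 = allWords-complete (sum-map≡length⇒≡1 ballCount ballCount-≤1 (allWords n)
    (trans sumWords-ballCount (trans size (sym (length-allWords n)))))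

  data Decoding (x : Word n) : Set where
    exact : x ∈ C → Decoding x
    near  : ∀ j → flip j x ∈ C → Decoding x

  decode : ∀ x → Decoding x
  decode x with C x in x∈C
  ... | true  = exact x∈C
  ... | false = uncurry near (∑-bit-witness {n} _ ((λ ()) ∘ trans (sym ∑≡1)))
    where
    ∑≡1 : ∑[ j < n ] bit (C (flip j x)) ≡ 1
    ∑≡1 = subst (λ b → bit b + ∑[ j < n ] bit (C (flip j x)) ≡ 1) x∈C (ballCount≡1 x)

  third-direction : ∀ {w} a b → flip a (flip b w) ∈ C → a ≢ b
    → ∃ λ m → m ≢ a × m ≢ b × flip m w ∈ C
  third-direction {w} a b ffw∈C a≢b with decode w
  ... | exact w∈C  = contradiction (flip-flip-∈⇒≡ a b w∈C ffw∈C) a≢b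
  ... | near m fw∈C = m , m≢a , m≢b , fw∈C
    where
    m≢a : m ≢ a
    m≢a refl = flip-∉ b fw∈C (subst (_∈ C) (flip-comm a b w) ffw∈C)
    m≢b : m ≢ b
    m≢b refl = flip-∉ a fw∈C ffw∈C

data Kind : Set where
  codeword shifted adjacent : Kind

-- The parity component is that of the nearest codeword (true: i-even).
Colour : Set
Colour = Kind × Bool

toggle : Colour → Colour
toggle (codeword , p) = shifted , p
toggle (shifted  , p) = codeword , p
toggle (adjacent , p) = adjacent , p

-- f filters the parity: id gives I, I + e_i, I_1 and not gives I', I' + e_i, I'_1.
codewordWith shiftedWith centralWith adjacentWith : (Bool → Bool) → Colour → Bool
codewordWith f (codeword , p) = f p
codewordWith f _              = false
shiftedWith  f c = codewordWith f (toggle c)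
centralWith  f c = codewordWith f c ∨ shiftedWith f c
adjacentWith f (adjacent , p) = f p
adjacentWith f _              = false

-- Read off from the neighbourhoods in Colouring.Neighbourhood.
neighbourCount : ℕ → (Colour → Bool) → Colour → ℕ
neighbourCount n Q (codeword , p) =
  sum (map (bit ∘ Q) ((shifted , p) ∷ [])) + (if Q (adjacent , p) then n ∸ 1 else 0)
neighbourCount n Q (shifted , p) =
  sum (map (bit ∘ Q) ((codeword , p) ∷ [])) + (if Q (adjacent , p) then n ∸ 1 else 0)
neighbourCount n Q (adjacent , p) =
  sum (map (bit ∘ Q) ((codeword , p) ∷ (shifted , p) ∷ (adjacent , p) ∷ []))
    + (if Q (adjacent , not p) then n ∸ 3 else 0)

distOne-centralWith : ∀ n f c
  → not (centralWith f c) ∧ (0 <ᵇ neighbourCount n (centralWith f) c) ≡ adjacentWith f c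
distOne-centralWith n f (codeword , p) with f p
... | true  = refl
... | false = refl
distOne-centralWith n f (shifted , p) with f p
... | true  = refl
... | false = refl
distOne-centralWith n f (adjacent , p) with f p
... | true  = refl
... | false = refl

sixColour : Colour → Fin 6
sixColour (codeword , true)  = 0F
sixColour (shifted  , true)  = 1F
sixColour (adjacent , true)  = 2F
sixColour (adjacent , false) = 3F
sixColour (shifted  , false) = 4F
sixColour (codeword , false) = 5F

fourColour : Colour → Fin 4
fourColour (adjacent , true)  = 1F
fourColour (adjacent , false) = 2F
fourColour (_        , true)  = 0F
fourColour (_        , false) = 3F

sixIndicator : Colour → Vec Bool 6
sixIndicator c = codewordWith id c ∷ shiftedWith id c ∷ adjacentWith id c
  ∷ adjacentWith not c ∷ shiftedWith not c ∷ codewordWith not c ∷ []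

fourIndicator : Colour → Vec Bool 4
fourIndicator c = centralWith id c ∷ adjacentWith id c ∷ adjacentWith not c ∷ centralWith not c ∷ []

sixIndicator-tabulate : ∀ c → sixIndicator c ≡ tabulate (λ a → does (sixColour c ≟ a))
sixIndicator-tabulate (codeword , true)  = refl
sixIndicator-tabulate (codeword , false) = refl
sixIndicator-tabulate (shifted  , true)  = refl
sixIndicator-tabulate (shifted  , false) = refl
sixIndicator-tabulate (adjacent , true)  = refl
sixIndicator-tabulate (adjacent , false) = refl

fourIndicator-tabulate : ∀ c → fourIndicator c ≡ tabulate (λ a → does (fourColour c ≟ a))
fourIndicator-tabulate (codeword , true)  = refl
fourIndicator-tabulate (codeword , false) = refl
fourIndicator-tabulate (shifted  , true)  = refl
fourIndicator-tabulate (shifted  , false) = refl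
fourIndicator-tabulate (adjacent , true)  = refl
fourIndicator-tabulate (adjacent , false) = refl

sixMatrix-rows : ∀ n c
  → lookup (sixMatrix n) (sixColour c)
    ≡ tabulate (λ b → neighbourCount n (λ c′ → does (sixColour c′ ≟ b)) c)
sixMatrix-rows n (codeword , true)  = refl
sixMatrix-rows n (codeword , false) = refl
sixMatrix-rows n (shifted  , true)  = refl
sixMatrix-rows n (shifted  , false) = refl
sixMatrix-rows n (adjacent , true)  = refl
sixMatrix-rows n (adjacent , false) = refl

fourMatrix-rows : ∀ n c
  → lookup (fourMatrix n) (fourColour c)
    ≡ tabulate (λ b → neighbourCount n (λ c′ → does (fourColour c′ ≟ b)) c)
fourMatrix-rows n (codeword , true)  = refl
fourMatrix-rows n (codeword , false) = refl
fourMatrix-rows n (shifted  , true)  = refl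
fourMatrix-rows n (shifted  , false) = refl
fourMatrix-rows n (adjacent , true)  = refl
fourMatrix-rows n (adjacent , false) = refl

-- The colouring induced by a perfect code

module Colouring {n} (C : VSet n)
  (separated : (x y : Word n) → x ∈ C → y ∈ C → x ≢ y → 3 ≤ dist x y)
  (size : card C * (n + 1) ≡ 2 ^ n) (i : Fin n) where

  open PerfectCode C separated size

  kindAlong : Fin n → Kind
  kindAlong j = if does (j ≟ i) then shifted else adjacent

  colour : ∀ {x} → Decoding x → Colour
  colour {x} (exact _)  = codeword , iEven i x
  colour {x} (near j _) = kindAlong j , iEven i (flip j x)

  col : Word n → Colour
  col x = colour (decode x)

  colour-unique : ∀ {x} (d e : Decoding x) → colour d ≡ colour e
  colour-unique (exact _)     (exact _)     = refl
  colour-unique (exact x∈C)   (near j fx∈C) = contradiction fx∈C (flip-∉ j x∈C)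
  colour-unique (near j fx∈C) (exact x∈C)   = contradiction fx∈C (flip-∉ j x∈C)
  colour-unique (near j j∈C)  (near k k∈C) with near-unique j∈C k∈C
  ... | refl = refl

  col-exact : ∀ {x} → x ∈ C → col x ≡ (codeword , iEven i x)
  col-exact {x} x∈C = colour-unique (decode x) (exact x∈C)

  col-shifted : ∀ {x} → flip i x ∈ C → col x ≡ (shifted , iEven i x)
  col-shifted {x} fx∈C = trans (colour-unique (decode x) (near i fx∈C))
    (cong₂ _,_ (cong (if_then shifted else adjacent) (dec-true (i ≟ i) refl)) (iEven-flip-self i x))

  col-adjacent : ∀ {x j} → flip j x ∈ C → j ≢ i → col x ≡ (adjacent , not (iEven i x))
  col-adjacent {x} {j} fx∈C j≢i = trans (colour-unique (decode x) (near j fx∈C))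
    (cong₂ _,_ (cong (if_then shifted else adjacent) (dec-false (j ≟ i) j≢i)) (iEven-flip x j≢i))

  data Neighbourhood (y : Word n) : Colour → Set where
    atCodeword : ∀ p → col (flip i y) ≡ (shifted , p)
      → (∀ l → l ≢ i → col (flip l y) ≡ (adjacent , p))
      → Neighbourhood y (codeword , p)
    atShifted  : ∀ p → col (flip i y) ≡ (codeword , p)
      → (∀ l → l ≢ i → col (flip l y) ≡ (adjacent , p))
      → Neighbourhood y (shifted , p)
    atAdjacent : ∀ p j k → Unique (j ∷ k ∷ i ∷ [])
      → col (flip j y) ≡ (codeword , p) → col (flip k y) ≡ (shifted , p)
      → col (flip i y) ≡ (adjacent , p)
      → (∀ l → All (l ≢_) (j ∷ k ∷ i ∷ []) → col (flip l y) ≡ (adjacent , not p))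
      → Neighbourhood y (adjacent , p)

  codewordNeighbourhood : ∀ {y} → y ∈ C → Neighbourhood y (col y)
  codewordNeighbourhood {y} y∈C =
    subst (Neighbourhood y) (sym (col-exact y∈C)) (atCodeword (iEven i y) axis others)
    where
    axis : col (flip i y) ≡ (shifted , iEven i y)
    axis = trans (col-shifted (∈-refold i id y∈C)) (cong (shifted ,_) (iEven-flip-self i y))
    others : ∀ l → l ≢ i → col (flip l y) ≡ (adjacent , iEven i y)
    others l l≢i = trans (col-adjacent (∈-refold l id y∈C) l≢i) (cong (adjacent ,_) (not-iEven-flip y l≢i))

  shiftedNeighbourhood : ∀ {y} → flip i y ∈ C → Neighbourhood y (col y)
  shiftedNeighbourhood {y} fy∈C =
    subst (Neighbourhood y) (sym (col-shifted fy∈C)) (atShifted (iEven i y) axis others)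
    where
    axis : col (flip i y) ≡ (codeword , iEven i y)
    axis = trans (col-exact fy∈C) (cong (codeword ,_) (iEven-flip-self i y))
    others : ∀ l → l ≢ i → col (flip l y) ≡ (adjacent , iEven i y)
    others l l≢i with third-direction i l (∈-refold l (flip i) fy∈C) (l≢i ∘ sym)
    ... | m , m≢i , _ , fw∈C = trans (col-adjacent fw∈C m≢i) (cong (adjacent ,_) (not-iEven-flip y l≢i))

  adjacentNeighbourhood : ∀ {y j} → flip j y ∈ C → j ≢ i → Neighbourhood y (col y)
  adjacentNeighbourhood {y} {j} fy∈C j≢i
    with third-direction j i (∈-refold i (flip j) fy∈C) j≢i
  ... | k , k≢j , k≢i , fk∈C =
    subst (Neighbourhood y) (sym (col-adjacent fy∈C j≢i)) (atAdjacent p j k distinct atJ atK atI others)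
    where
    p = not (iEven i y)
    distinct : Unique (j ∷ k ∷ i ∷ [])
    distinct = ((k≢j ∘ sym) ∷ j≢i ∷ []) ∷ (k≢i ∷ []) ∷ [] ∷ []
    atJ : col (flip j y) ≡ (codeword , p)
    atJ = trans (col-exact fy∈C) (cong (codeword ,_) (iEven-flip y j≢i))
    atK : col (flip k y) ≡ (shifted , p)
    atK = trans (col-shifted (subst (_∈ C) (flip-comm k i y) fk∈C)) (cong (shifted ,_) (iEven-flip y k≢i))
    atI : col (flip i y) ≡ (adjacent , p)
    atI = trans (col-adjacent fk∈C k≢i) (cong (adjacent ,_) (cong not (iEven-flip-self i y)))
    others : ∀ l → All (l ≢_) (j ∷ k ∷ i ∷ []) → col (flip l y) ≡ (adjacent , not p)
    others l (l≢j ∷ l≢k ∷ l≢i ∷ [])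
      with third-direction j l (∈-refold l (flip j) fy∈C) (l≢j ∘ sym)
    ... | m , _ , _ , fw∈C = trans (col-adjacent fw∈C m≢i) (cong (adjacent ,_) (cong not (iEven-flip y l≢i)))
      where
      -- flip i (flip l y) and flip k (flip i y) would be codewords at distance 2.
      m≢i : m ≢ i
      m≢i refl = l≢k (near-unique (subst (_∈ C) (flip-comm i l y) fw∈C) fk∈C)

  neighbourhood : ∀ y → Neighbourhood y (col y)
  neighbourhood y = fromDecoding (decode y)
    where
    fromDecoding : Decoding y → Neighbourhood y (col y)
    fromDecoding (exact y∈C) = codewordNeighbourhood y∈C
    fromDecoding (near j fy∈C) with j ≟ i
    ... | yes refl = shiftedNeighbourhood fy∈C
    ... | no j≢i   = adjacentNeighbourhood fy∈C j≢i

  col-flip-axis : ∀ y → col (flip i y) ≡ toggle (col y)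
  col-flip-axis y = axis (neighbourhood y)
    where
    axis : ∀ {c} → Neighbourhood y c → col (flip i y) ≡ toggle c
    axis (atCodeword _ ax _)             = ax
    axis (atShifted _ ax _)              = ax
    axis (atAdjacent _ _ _ _ _ _ ax _)   = ax

  count-neighbours : ∀ (Q : Colour → Bool) y
    → ∑[ l < n ] bit (Q (col (flip l y))) ≡ neighbourCount n Q (col y)
  count-neighbours Q y = count (neighbourhood y)
    where
    h : Fin n → ℕ
    h l = bit (Q (col (flip l y)))
    profile : ∀ js cs d → Unique js → map (λ l → col (flip l y)) js ≡ cs
      → (∀ l → All (l ≢_) js → col (flip l y) ≡ d)
      → ∑[ l < n ] h l ≡ sum (map (bit ∘ Q) cs) + (if Q d then n ∸ length js else 0)
    profile js cs d distinct special others = begin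
      ∑[ l < n ] h l
        ≡⟨ ∑-default h js (bit (Q d)) distinct (λ l → cong (bit ∘ Q) ∘ others l) ⟩
      sum (map h js) + (n ∸ length js) * bit (Q d)
        ≡⟨ cong₂ _+_ (trans (cong sum (map-∘ js)) (cong (sum ∘ map (bit ∘ Q)) special))
                     (*-bit (n ∸ length js) (Q d)) ⟩
      sum (map (bit ∘ Q) cs) + (if Q d then n ∸ length js else 0) ∎
    count : ∀ {c} → Neighbourhood y c → ∑[ l < n ] h l ≡ neighbourCount n Q c
    count (atCodeword p ax others) =
      profile (i ∷ []) _ _ ([] ∷ []) (cong (_∷ []) ax) λ { l (l≢i ∷ []) → others l l≢i }
    count (atShifted p ax others)  =
      profile (i ∷ []) _ _ ([] ∷ []) (cong (_∷ []) ax) λ { l (l≢i ∷ []) → others l l≢i }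
    count (atAdjacent p j k distinct atJ atK atI others) =
      profile (j ∷ k ∷ i ∷ []) _ _ distinct (cong₂ _∷_ atJ (cong₂ _∷_ atK (cong (_∷ []) atI))) others

  codewordWith-col : ∀ f y → C y ∧ f (iEven i y) ≡ codewordWith f (col y)
  codewordWith-col f y = part (decode y)
    where
    notCodeword : ∀ {j} → flip j y ∈ C → codewordWith f (col y) ≡ false
    notCodeword {j} fy∈C with j ≟ i
    ... | yes refl = cong (codewordWith f) (col-shifted fy∈C)
    ... | no j≢i   = cong (codewordWith f) (col-adjacent fy∈C j≢i)
    part : Decoding y → C y ∧ f (iEven i y) ≡ codewordWith f (col y)
    part (exact y∈C)   = trans (cong (_∧ f (iEven i y)) y∈C) (cong (codewordWith f) (sym (col-exact y∈C)))
    part (near j fy∈C) =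
      trans (cong (_∧ f (iEven i y)) (¬-not (λ y∈C → flip-∉ j y∈C fy∈C))) (sym (notCodeword fy∈C))

  shiftedWith-col : ∀ f y → C (flip i y) ∧ f (iEven i (flip i y)) ≡ shiftedWith f (col y)
  shiftedWith-col f y = trans (codewordWith-col f (flip i y)) (cong (codewordWith f) (col-flip-axis y))

  centralSet : (Bool → Bool) → VSet n
  centralSet f z = (C z ∧ f (iEven i z)) ∨ (C (flip i z) ∧ f (iEven i (flip i z)))

  centralWith-col : ∀ f y → centralSet f y ≡ centralWith f (col y)
  centralWith-col f y = cong₂ _∨_ (codewordWith-col f y) (shiftedWith-col f y)

  adjacentWith-col : ∀ f y → distOne (centralSet f) y ≡ adjacentWith f (col y)
  adjacentWith-col f y = begin
    not (centralSet f y) ∧ any (λ l → centralSet f (flip l y)) (allFin n)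
      ≡⟨ cong₂ (λ a b → not a ∧ b) (centralWith-col f y) (any-allFin (λ l → centralSet f (flip l y))) ⟩
    not (P (col y)) ∧ (0 <ᵇ ∑[ l < n ] bit (centralSet f (flip l y)))
      ≡⟨ cong (λ s → not (P (col y)) ∧ (0 <ᵇ s)) neighbours ⟩
    not (P (col y)) ∧ (0 <ᵇ neighbourCount n P (col y))
      ≡⟨ distOne-centralWith n f (col y) ⟩
    adjacentWith f (col y) ∎
    where
    P = centralWith f
    neighbours : ∑[ l < n ] bit (centralSet f (flip l y)) ≡ neighbourCount n P (col y)
    neighbours = trans (sum-cong-≗ (λ l → cong bit (centralWith-col f (flip l y)))) (count-neighbours P y)

  perfectColoring-byColour : ∀ {t} (κ : Colour → Fin t) (S : Vec (VSet n) t)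
    (indicator : Colour → Vec Bool t) (M : Vec (Vec ℕ t) t)
    → (∀ y → Vec.map (λ T → T y) S ≡ indicator (col y))
    → (∀ c → indicator c ≡ tabulate (λ a → does (κ c ≟ a)))
    → (∀ c → lookup M (κ c) ≡ tabulate (λ b → neighbourCount n (λ c′ → does (κ c′ ≟ b)) c))
    → IsPerfectColoring (lookup S) (mat M)
  perfectColoring-byColour κ S indicator M members indicator-tabulate rows =
    perfectColoring (lookup S) (κ ∘ col) (mat M) classes counts
    where
    classes : ∀ a y → lookup S a y ≡ does (κ (col y) ≟ a)
    classes a y = begin
      lookup S a y                                        ≡⟨ lookup-map a (λ T → T y) S ⟨
      lookup (Vec.map (λ T → T y) S) a                    ≡⟨ cong (λ v → lookup v a) (members y) ⟩
      lookup (indicator (col y)) a                        ≡⟨ cong (λ v → lookup v a) (indicator-tabulate (col y)) ⟩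
      lookup (tabulate (λ a′ → does (κ (col y) ≟ a′))) a  ≡⟨ lookup∘tabulate _ a ⟩
      does (κ (col y) ≟ a)                                ∎
    counts : ∀ y b → ∑[ l < n ] bit (does (κ (col (flip l y)) ≟ b)) ≡ mat M (κ (col y)) b
    counts y b = begin
      ∑[ l < n ] bit (does (κ (col (flip l y)) ≟ b))      ≡⟨ count-neighbours (λ c → does (κ c ≟ b)) y ⟩
      neighbourCount n (λ c → does (κ c ≟ b)) (col y)     ≡⟨ lookup∘tabulate _ b ⟨
      lookup (tabulate (λ b′ → neighbourCount n (λ c → does (κ c ≟ b′)) (col y))) b
                                                          ≡⟨ cong (λ v → lookup v b) (rows (col y)) ⟨
      mat M (κ (col y)) b                                 ∎

  sixColouring : IsPerfectColoring (lookup (sixClasses C i)) (mat (sixMatrix n))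
  sixColouring = perfectColoring-byColour sixColour (sixClasses C i) sixIndicator (sixMatrix n)
    (λ y → Pointwise-≡⇒≡ (codewordWith-col id y ∷ shiftedWith-col id y ∷ adjacentWith-col id y
                           ∷ adjacentWith-col not y ∷ shiftedWith-col not y ∷ codewordWith-col not y ∷ []))
    sixIndicator-tabulate (sixMatrix-rows n)

  fourColouring : IsPerfectColoring (lookup (fourClasses C i)) (mat (fourMatrix n))
  fourColouring = perfectColoring-byColour fourColour (fourClasses C i) fourIndicator (fourMatrix n)
    (λ y → Pointwise-≡⇒≡ (centralWith-col id y ∷ adjacentWith-col id y
                           ∷ adjacentWith-col not y ∷ centralWith-col not y ∷ []))
    fourIndicator-tabulate (fourMatrix-rows n)

mainTheorem12 : (r : ℕ) (C : VSet (2 ^ r ∸ 1)) (i : Fin (2 ^ r ∸ 1))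
    → IsPerfectCode C
    → IsPerfectColoring (lookup (sixClasses C i)) (mat (sixMatrix (2 ^ r ∸ 1)))
      × IsPerfectColoring (lookup (fourClasses C i)) (mat (fourMatrix (2 ^ r ∸ 1)))
mainTheorem12 r C i (separated , size) = sixColouring , fourColouring
  where open Colouring C separated size i
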